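{- Let $b\neq 3$ be a positive integer. Then there are only finitely many positive integers $n$ satisfying $$\sigma_2(n)-n^2=\sum_{d\mid n,\ d<n} d^2 = bn.$$ In particular, for $b=1$ and for $b=2$ there is no positive integer $n$ satisfying this equation.
   Context: For a positive integer $n$ and a positive integer $a$, $\sigma_a(n)=\sum_{d\mid n} d^a$ denotes the sum of the $a$-th powers of the positive divisors of $n$. -}

module Defs where

open import Data.Nat using (ℕ; suc; _^_)
open import Data.Nat.Divisibility using (_∣?_)
open import Data.List using (List; filter; applyUpTo; map)
open import Data.Nat.ListAction using (sum)

divisors : ℕ → List ℕ
divisors n = filter (_∣? n) (applyUpTo suc n)

σ : ℕ → ℕ → ℕ
σ a n = sum (map (_^ a) (divisors n))

{-# OPTIONS --safe #-}
-- Write n = p m with p the least prime factor of n. If m is composite, both of its factors are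
-- at least p, so p² ≤ m, while comparing σ₂(n) with n² + m² gives m ≤ b p; hence p ≤ b and
-- n ≤ b³. If m = 1 or m = p, the equation reduces modulo p to p ∣ 1. If m is a prime q > p, then
-- σ₂(n) = 1 + p² + q² + n² turns it into p² + q² + 1 = b p q, and Vieta jumping forces b = 3.
-- For b = 1, 2 it remains to check the finitely many n ≤ b³.
module Submission where

open import Defs
open import Data.Nat using (ℕ; _+_; _*_; _^_; _≤_; NonZero)
open import Data.Product using (∃; _×_)
open import Relation.Binary.PropositionalEquality using (_≡_; _≢_)
open import Relation.Nullary using (¬_)

open import Data.Empty using (⊥-elim)
open import Data.List using (List; []; _∷_; _++_; map; applyUpTo)
open import Data.List.Membership.Propositional using (_∈_)
open import Data.List.Membership.Propositional.Properties
  using (∈-∃++; ∈-++⁻; ∈-++⁺ˡ; ∈-++⁺ʳ; ∈-filter⁺; ∈-filter⁻; ∈-applyUpTo⁺)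
open import Data.List.Relation.Binary.Permutation.Propositional using (↭-sym)
open import Data.List.Relation.Binary.Permutation.Propositional.Properties using (shift; map⁺)
open import Data.List.Relation.Binary.Subset.Propositional using (_⊆_)
open import Data.List.Relation.Unary.All as All using (All; []; _∷_)
import Data.List.Relation.Unary.AllPairs as AllPairs
open import Data.List.Relation.Unary.Any using (here; there)
open import Data.List.Relation.Unary.Linked using (Linked; []; [-]; _∷_)
open import Data.List.Relation.Unary.Linked.Properties using (Linked⇒AllPairs)
open import Data.List.Relation.Unary.Unique.Propositional using (Unique; []; _∷_)
import Data.List.Relation.Unary.Unique.Propositional.Properties as Unique
open import Data.Nat.Base
  using (zero; suc; _<_; _∸_; z≤n; s≤s; NonTrivial; ≢-nonZero; ≢-nonZero⁻¹; >-nonZero; >-nonZero⁻¹;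
         nonTrivial⇒n>1; n>1⇒nonTrivial)
open import Data.Nat.Coprimality using (Coprime; coprime-divisor)
open import Data.Nat.Divisibility
  using (_∣_; _∣?_; divides; quotient; 1∣_; ∣-refl; ∣-reflexive; ∣-trans; ∣⇒≤; 0∣⇒≡0; ∣1⇒≡1;
         m∣m*n; n∣m*n; ∣m+n∣m⇒∣n; ∣m∣n⇒∣m+n; *-cancelˡ-∣; quotient>1; quotient-∣; m∣n⇒n≡m*quotient)
open import Data.Nat.Divisibility.Core using (hasNonTrivialDivisor)
open import Data.Nat.Induction using (<-rec)
open import Data.Nat.ListAction using (sum)
open import Data.Nat.ListAction.Properties using (sum-↭)
open import Data.Nat.Primality
  using (Prime; prime; Composite; _Rough_; composite?; ¬composite⇒prime; prime⇒irreducible;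
         prime⇒nonZero; 2-rough; ∤⇒rough-suc; rough∧∣⇒prime)
open import Data.Nat.Properties
open import Data.Nat.Tactic.RingSolver using (solve-∀)
open import Data.Product using (_,_; proj₂)
open import Data.Sum using (_⊎_; inj₁; inj₂)
open import Relation.Binary.PropositionalEquality using (refl; sym; trans; subst; cong; cong₂; module ≡-Reasoning)
open import Relation.Nullary using (Dec; yes; no; ¬?)
open import Relation.Nullary.Decidable using (True; toWitness)

sum-map-mono-⊆ : ∀ {a} {A : Set a} (f : A → ℕ) {xs ys : List A} →
                 Unique xs → xs ⊆ ys → sum (map f xs) ≤ sum (map f ys)
sum-map-mono-⊆ f [] _ = z≤n
sum-map-mono-⊆ f {x ∷ xs} (x∉xs ∷ xs!) x∷xs⊆ys with ∈-∃++ (x∷xs⊆ys (here refl))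
... | as , bs , refl = begin
  f x + sum (map f xs)          ≤⟨ +-monoʳ-≤ (f x) (sum-map-mono-⊆ f xs! xs⊆as++bs) ⟩
  sum (map f (x ∷ as ++ bs))    ≡⟨ sum-↭ (map⁺ f (↭-sym (shift x as bs))) ⟩
  sum (map f (as ++ x ∷ bs))    ∎
  where
  open ≤-Reasoning
  xs⊆as++bs : xs ⊆ as ++ bs
  xs⊆as++bs {z} z∈xs with ∈-++⁻ as (x∷xs⊆ys (there z∈xs))
  ... | inj₁ z∈as           = ∈-++⁺ˡ z∈as
  ... | inj₂ (here refl)    = ⊥-elim (All.lookup x∉xs z∈xs refl)
  ... | inj₂ (there z∈bs)   = ∈-++⁺ʳ as z∈bs

module _ {n : ℕ} where

  ∈-divisors⁻ : ∀ {d} → d ∈ divisors n → d ∣ n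
  ∈-divisors⁻ d∈ = proj₂ (∈-filter⁻ (_∣? n) {xs = applyUpTo suc n} d∈)

  ∈-divisors⁺ : ∀ {d} → .{{NonZero n}} → d ∣ n → d ∈ divisors n
  ∈-divisors⁺ {zero}  0∣n = ⊥-elim (≢-nonZero⁻¹ n (0∣⇒≡0 0∣n))
  ∈-divisors⁺ {suc i} d∣n = ∈-filter⁺ (_∣? n) (∈-applyUpTo⁺ suc (∣⇒≤ d∣n)) d∣n

  divisors-unique : Unique (divisors n)
  divisors-unique = Unique.filter⁺ (_∣? n) (Unique.applyUpTo⁺₁ suc n (λ i<j _ → <⇒≢ (s≤s i<j)))

  sum≤σ : ∀ a {ds} → .{{NonZero n}} → Unique ds → All (_∣ n) ds → sum (map (_^ a) ds) ≤ σ a n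
  sum≤σ a ds! ds∣n = sum-map-mono-⊆ (_^ a) ds! (λ d∈ds → ∈-divisors⁺ (All.lookup ds∣n d∈ds))

  σ≡sum : ∀ a {ds} → .{{NonZero n}} → Unique ds → All (_∣ n) ds → (∀ {d} → d ∣ n → d ∈ ds) →
          σ a n ≡ sum (map (_^ a) ds)
  σ≡sum a ds! ds∣n complete = ≤-antisym
    (sum-map-mono-⊆ (_^ a) divisors-unique (λ d∈ → complete (∈-divisors⁻ d∈)))
    (sum≤σ a ds! ds∣n)

<-linked⇒unique : ∀ {xs} → Linked _<_ xs → Unique xs
<-linked⇒unique xs< = AllPairs.map <⇒≢ (Linked⇒AllPairs <-trans xs<)

prime>1 : ∀ {p} → Prime p → 1 < p
prime>1 {p} (prime _) = nonTrivial⇒n>1 p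

∣-prime*prime : ∀ {p q d} → Prime p → Prime q → d ∣ p * q → d ≡ 1 ⊎ d ≡ p ⊎ d ≡ q ⊎ d ≡ p * q
∣-prime*prime {p} {q} {d} p-prime q-prime d∣pq with p ∣? d
... | yes (divides e refl)
    with prime⇒irreducible q-prime
           (*-cancelˡ-∣ p {{prime⇒nonZero p-prime}} (subst (_∣ p * q) (*-comm e p) d∣pq))
...   | inj₁ refl = inj₂ (inj₁ (*-identityˡ p))
...   | inj₂ refl = inj₂ (inj₂ (inj₂ (*-comm e p)))
∣-prime*prime {p} {q} {d} p-prime q-prime d∣pq | no p∤d
    with prime⇒irreducible q-prime (coprime-divisor d⊥p d∣pq)
  where
  d⊥p : Coprime d p
  d⊥p (i∣d , i∣p) with prime⇒irreducible p-prime i∣p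
  ... | inj₁ i≡1    = i≡1
  ... | inj₂ refl   = ⊥-elim (p∤d i∣d)
... | inj₁ d≡1 = inj₁ d≡1
... | inj₂ d≡q = inj₂ (inj₂ (inj₁ d≡q))

module _ (a : ℕ) {p : ℕ} (p-prime : Prime p) where
  private
    instance
      p≢0 : NonZero p
      p≢0 = prime⇒nonZero p-prime
    1<p : 1 < p
    1<p = prime>1 p-prime

  σ-prime : σ a p ≡ 1 + p ^ a
  σ-prime = begin
    σ a p                ≡⟨ σ≡sum a (<-linked⇒unique (1<p ∷ [-])) (1∣ p ∷ ∣-refl ∷ []) divisor∈ ⟩
    1 ^ a + (p ^ a + 0)  ≡⟨ cong₂ _+_ (^-zeroˡ a) (+-identityʳ _) ⟩
    1 + p ^ a            ∎
    where
    open ≡-Reasoning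
    divisor∈ : ∀ {d} → d ∣ p → d ∈ 1 ∷ p ∷ []
    divisor∈ d∣p with prime⇒irreducible p-prime d∣p
    ... | inj₁ refl = here refl
    ... | inj₂ refl = there (here refl)

  σ-prime² : σ a (p * p) ≡ 1 + (p ^ a + (p * p) ^ a)
  σ-prime² = begin
    σ a (p * p)                         ≡⟨ σ≡sum a {{m*n≢0 p p}} (<-linked⇒unique (1<p ∷ m<m*n p p 1<p ∷ [-]))
                                                   (1∣ _ ∷ m∣m*n p ∷ ∣-refl ∷ []) divisor∈ ⟩
    1 ^ a + (p ^ a + ((p * p) ^ a + 0)) ≡⟨ cong₂ _+_ (^-zeroˡ a) (cong (p ^ a +_) (+-identityʳ _)) ⟩
    1 + (p ^ a + (p * p) ^ a)           ∎
    where
    open ≡-Reasoning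
    divisor∈ : ∀ {d} → d ∣ p * p → d ∈ 1 ∷ p ∷ p * p ∷ []
    divisor∈ d∣p² with ∣-prime*prime p-prime p-prime d∣p²
    ... | inj₁ refl                = here refl
    ... | inj₂ (inj₁ refl)         = there (here refl)
    ... | inj₂ (inj₂ (inj₁ refl))  = there (here refl)
    ... | inj₂ (inj₂ (inj₂ refl))  = there (there (here refl))

  σ-prime*prime : ∀ {q} → Prime q → p < q → σ a (p * q) ≡ 1 + (p ^ a + (q ^ a + (p * q) ^ a))
  σ-prime*prime {q} q-prime p<q = begin
    σ a (p * q)
      ≡⟨ σ≡sum a {{m*n≢0 p q {{p≢0}} {{prime⇒nonZero q-prime}}}}
               (<-linked⇒unique (1<p ∷ p<q ∷ q<pq ∷ [-])) (1∣ _ ∷ m∣m*n q ∷ n∣m*n p ∷ ∣-refl ∷ []) divisor∈ ⟩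
    1 ^ a + (p ^ a + (q ^ a + ((p * q) ^ a + 0)))
      ≡⟨ cong₂ _+_ (^-zeroˡ a) (cong (p ^ a +_) (cong (q ^ a +_) (+-identityʳ _))) ⟩
    1 + (p ^ a + (q ^ a + (p * q) ^ a)) ∎
    where
    open ≡-Reasoning
    q<pq : q < p * q
    q<pq = subst (q <_) (*-comm q p) (m<m*n q p {{prime⇒nonZero q-prime}} 1<p)
    divisor∈ : ∀ {d} → d ∣ p * q → d ∈ 1 ∷ p ∷ q ∷ p * q ∷ []
    divisor∈ d∣pq with ∣-prime*prime p-prime q-prime d∣pq
    ... | inj₁ refl                = here refl
    ... | inj₂ (inj₁ refl)         = there (here refl)
    ... | inj₂ (inj₂ (inj₁ refl))  = there (there (here refl))
    ... | inj₂ (inj₂ (inj₂ refl))  = there (there (there (here refl)))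

σ-proper-divisor : ∀ a {n d} → .{{NonZero n}} → d ∣ n → d < n → n ^ a + d ^ a ≤ σ a n
σ-proper-divisor a {n} {d} d∣n d<n = begin
  n ^ a + d ^ a                     ≡⟨ cong (n ^ a +_) (+-identityʳ (d ^ a)) ⟨
  sum (map (_^ a) (n ∷ d ∷ []))     ≤⟨ sum≤σ a ((>⇒≢ d<n ∷ []) ∷ [] ∷ []) (∣-refl ∷ d∣n ∷ []) ⟩
  σ a n                             ∎
  where open ≤-Reasoning

Markov : ℕ → ℕ → ℕ → Set
Markov b x y = x * x + y * y + 1 ≡ b * (x * y)

markov-sym : ∀ {b x y} → Markov b x y → Markov b y x
markov-sym {b} {x} {y} eq = begin
  y * y + x * x + 1   ≡⟨ cong (_+ 1) (+-comm (y * y) (x * x)) ⟩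
  x * x + y * y + 1   ≡⟨ eq ⟩
  b * (x * y)         ≡⟨ cong (b *_) (*-comm x y) ⟩
  b * (y * x)         ∎
  where open ≡-Reasoning

markov-diagonal : ∀ {b x} → Markov b x x → b ≡ 3
markov-diagonal {b} {x} eq = begin
  b                  ≡⟨ *-identityʳ b ⟨
  b * 1              ≡⟨ cong (b *_) x²≡1 ⟨
  b * (x * x)        ≡⟨ eq ⟨
  x * x + x * x + 1  ≡⟨ cong (λ X → X + X + 1) x²≡1 ⟩
  3                  ∎
  where
  open ≡-Reasoning
  x²≡1 : x * x ≡ 1
  x²≡1 = ∣1⇒≡1 (∣m+n∣m⇒∣n (subst (x * x ∣_) (sym eq) (n∣m*n b)) (∣m∣n⇒∣m+n ∣-refl ∣-refl))

-- Vieta jumping: y′ = b x − y is the other root of Y² − b x Y + x² + 1, so y y′ = x² + 1 and y′ ≤ x.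
markov-descent : ∀ {b x y} → x < y → Markov b x y → ∃ λ y′ → y′ ≤ x × Markov b x y′
markov-descent {b} {x} {y} x<y eq = y′ , y′≤x , markov′
  where
  instance
    x≢0 : NonZero x
    x≢0 = ≢-nonZero λ { refl → 1+n≢0 (m+n≡0⇒n≡0 (y * y) (trans eq (*-zeroʳ b))) }
    y≢0 : NonZero y
    y≢0 = >-nonZero (≤-<-trans z≤n x<y)
  y≤bx : y ≤ b * x
  y≤bx = *-cancelʳ-≤ y (b * x) y (begin
    y * y                ≤⟨ m≤n+m (y * y) (x * x) ⟩
    x * x + y * y        ≤⟨ m≤m+n _ 1 ⟩
    x * x + y * y + 1    ≡⟨ eq ⟩
    b * (x * y)          ≡⟨ *-assoc b x y ⟨
    b * x * y            ∎)
    where open ≤-Reasoning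
  y′ : ℕ
  y′ = b * x ∸ y
  y+y′≡bx : y + y′ ≡ b * x
  y+y′≡bx = m+[n∸m]≡n y≤bx
  y′y≡x²+1 : y′ * y ≡ x * x + 1
  y′y≡x²+1 = +-cancelˡ-≡ (y * y) _ _ (begin
    y * y + y′ * y       ≡⟨ *-distribʳ-+ y y y′ ⟨
    (y + y′) * y         ≡⟨ cong (_* y) y+y′≡bx ⟩
    b * x * y            ≡⟨ *-assoc b x y ⟩
    b * (x * y)          ≡⟨ eq ⟨
    x * x + y * y + 1    ≡⟨ rearrange (x * x) (y * y) ⟩
    y * y + (x * x + 1)  ∎)
    where
    open ≡-Reasoning
    rearrange : ∀ u v → u + v + 1 ≡ v + (u + 1)
    rearrange = solve-∀
  y′≤x : y′ ≤ x
  y′≤x = *-cancelʳ-≤ y′ x y (begin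
    y′ * y               ≡⟨ y′y≡x²+1 ⟩
    x * x + 1            ≤⟨ +-monoʳ-≤ (x * x) (>-nonZero⁻¹ x) ⟩
    x * x + x            ≡⟨ +-comm (x * x) x ⟩
    x + x * x            ≡⟨ *-suc x x ⟨
    x * suc x            ≤⟨ *-monoʳ-≤ x x<y ⟩
    x * y                ∎)
    where open ≤-Reasoning
  markov′ : Markov b x y′
  markov′ = begin
    x * x + y′ * y′ + 1    ≡⟨ +-assoc (x * x) (y′ * y′) 1 ⟩
    x * x + (y′ * y′ + 1)  ≡⟨ cong (x * x +_) (+-comm (y′ * y′) 1) ⟩
    x * x + (1 + y′ * y′)  ≡⟨ +-assoc (x * x) 1 (y′ * y′) ⟨
    x * x + 1 + y′ * y′    ≡⟨ cong (_+ y′ * y′) y′y≡x²+1 ⟨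
    y′ * y + y′ * y′       ≡⟨ *-distribˡ-+ y′ y y′ ⟨
    y′ * (y + y′)          ≡⟨ cong (y′ *_) y+y′≡bx ⟩
    y′ * (b * x)           ≡⟨ rearrange b x y′ ⟩
    b * (x * y′)           ∎
    where
    open ≡-Reasoning
    rearrange : ∀ b x y → y * (b * x) ≡ b * (x * y)
    rearrange = solve-∀

markov-ordered⇒≡3 : ∀ {b} y {x} → x ≤ y → Markov b x y → b ≡ 3
markov-ordered⇒≡3 {b} = <-rec Ordered descend
  where
  Ordered : ℕ → Set
  Ordered y = ∀ {x} → x ≤ y → Markov b x y → b ≡ 3
  descend : ∀ y → (∀ {z} → z < y → Ordered z) → Ordered y
  descend y rec {x} x≤y eq with m≤n⇒m<n∨m≡n x≤y
  ... | inj₂ refl = markov-diagonal {b} {x} eq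
  ... | inj₁ x<y with markov-descent {b} {x} {y} x<y eq
  ...   | y′ , y′≤x , markov′ = rec x<y y′≤x (markov-sym {b} {x} {y′} markov′)

markov⇒≡3 : ∀ {b x y} → Markov b x y → b ≡ 3
markov⇒≡3 {b} {x} {y} eq with ≤-total x y
... | inj₁ x≤y = markov-ordered⇒≡3 y x≤y eq
... | inj₂ y≤x = markov-ordered⇒≡3 x y≤x (markov-sym {b} {x} {y} eq)

leastPrimeFactor : ∀ n → .{{NonTrivial n}} → ∃ λ p → Prime p × p ∣ n × p Rough n
leastPrimeFactor n = search 2 (n ∸ 2) (m+[n∸m]≡n (nonTrivial⇒n>1 n)) 2-rough
  where
  search : ∀ m k → .{{NonTrivial m}} → m + k ≡ n → m Rough n → ∃ λ p → Prime p × p ∣ n × p Rough n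
  search m k m+k≡n m-rough with m ∣? n
  ... | yes m∣n = m , rough∧∣⇒prime m-rough m∣n , m∣n , m-rough
  search m zero    m+0≡n m-rough | no m∤n = ⊥-elim (m∤n (∣-reflexive (trans (sym (+-identityʳ m)) m+0≡n)))
  search m (suc k) m+k≡n m-rough | no m∤n =
    search (suc m) k {{n>1⇒nonTrivial (m<n⇒m<1+n (nonTrivial⇒n>1 m))}}
           (trans (sym (+-suc m k)) m+k≡n) (∤⇒rough-suc m∤n m-rough)

rough∧∣⇒≤ : ∀ {p n d} → .{{NonTrivial d}} → p Rough n → d ∣ n → p ≤ d
rough∧∣⇒≤ p-rough d∣n = ≮⇒≥ (λ d<p → p-rough (hasNonTrivialDivisor d<p d∣n))

-- σ₂(n) − n² = b n, with n² moved across to avoid truncated subtraction.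
Solution : ℕ → ℕ → Set
Solution b n = σ 2 n ≡ n ^ 2 + b * n

solution? : ∀ b n → Dec (Solution b n)
solution? b n = σ 2 n ≟ n ^ 2 + b * n

proper-divisor-bound : ∀ {b n d} → .{{NonZero n}} → d ∣ n → d < n → Solution b n → d ^ 2 ≤ b * n
proper-divisor-bound {n = n} d∣n d<n sol =
  +-cancelˡ-≤ (n ^ 2) _ _ (≤-trans (σ-proper-divisor 2 d∣n d<n) (≤-reflexive sol))

prime∤1 : ∀ {p} → Prime p → ¬ p ∣ 1
prime∤1 p-prime p∣1 = >⇒≢ (prime>1 p-prime) (∣1⇒≡1 p∣1)

prime-not-solution : ∀ {b p} → Prime p → ¬ Solution b p
prime-not-solution {b} {p} p-prime sol = prime∤1 p-prime (divides b 1≡bp)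
  where
  1≡bp : 1 ≡ b * p
  1≡bp = +-cancelˡ-≡ (p ^ 2) 1 (b * p) (trans (+-comm (p ^ 2) 1) (trans (sym (σ-prime 2 p-prime)) sol))

prime²-not-solution : ∀ {b p} → Prime p → ¬ Solution b (p * p)
prime²-not-solution {b} {p} p-prime sol =
  prime∤1 p-prime (∣m+n∣m⇒∣n (subst (p ∣_) (sym p²+1≡bp²) (∣-trans (m∣m*n p) (n∣m*n b))) (m∣m*n _))
  where
  p²+1≡bp² : p ^ 2 + 1 ≡ b * (p * p)
  p²+1≡bp² = +-cancelˡ-≡ ((p * p) ^ 2) _ _ (begin
    (p * p) ^ 2 + (p ^ 2 + 1)          ≡⟨ rearrange p ⟩
    1 + (p ^ 2 + (p * p) ^ 2)          ≡⟨ σ-prime² 2 p-prime ⟨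
    σ 2 (p * p)                        ≡⟨ sol ⟩
    (p * p) ^ 2 + b * (p * p)          ∎)
    where
    open ≡-Reasoning
    -- _^ 2 is written out, since the ring solver does not accept _^_.
    rearrange : ∀ x → x * x * (x * x * 1) + (x * (x * 1) + 1) ≡ 1 + (x * (x * 1) + x * x * (x * x * 1))
    rearrange = solve-∀

prime*prime-solution⇒≡3 : ∀ {b p q} → Prime p → Prime q → p < q → Solution b (p * q) → b ≡ 3
prime*prime-solution⇒≡3 {b} {p} {q} p-prime q-prime p<q sol =
  markov⇒≡3 {b} {p} {q} (+-cancelˡ-≡ ((p * q) ^ 2) _ _ (begin
    (p * q) ^ 2 + (p * p + q * q + 1)    ≡⟨ rearrange p q ⟩
    1 + (p ^ 2 + (q ^ 2 + (p * q) ^ 2))  ≡⟨ σ-prime*prime 2 p-prime q-prime p<q ⟨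
    σ 2 (p * q)                          ≡⟨ sol ⟩
    (p * q) ^ 2 + b * (p * q)            ∎))
  where
  open ≡-Reasoning
  rearrange : ∀ x y → x * y * (x * y * 1) + (x * x + y * y + 1)
                    ≡ 1 + (x * (x * 1) + (y * (y * 1) + x * y * (x * y * 1)))
  rearrange = solve-∀

rough-composite-bound : ∀ {b p m} → .{{NonZero p}} → p Rough (p * m) → Composite m →
                        m ^ 2 ≤ b * (p * m) → p * m ≤ b ^ 3
rough-composite-bound {b} {p} {m} p-rough (hasNonTrivialDivisor {d} d<m d∣m) m²≤bpm = begin
  p * m        ≤⟨ *-monoʳ-≤ p m≤bp ⟩
  p * (b * p)  ≡⟨ rearrange p b ⟩
  b * (p * p)  ≤⟨ *-monoʳ-≤ b (*-mono-≤ p≤b p≤b) ⟩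
  b * (b * b)  ≡⟨ cong (λ x → b * (b * x)) (*-identityʳ b) ⟨
  b ^ 3        ∎
  where
  open ≤-Reasoning
  e : ℕ
  e = quotient d∣m
  instance
    m≢0 : NonZero m
    m≢0 = >-nonZero (≤-<-trans z≤n d<m)
    e>1 : NonTrivial e
    e>1 = n>1⇒nonTrivial (quotient>1 d∣m d<m)
  p≤factor : ∀ {f} → .{{NonTrivial f}} → f ∣ m → p ≤ f
  p≤factor f∣m = rough∧∣⇒≤ p-rough (∣-trans f∣m (n∣m*n p))
  p²≤m : p * p ≤ m
  p²≤m = begin
    p * p  ≤⟨ *-mono-≤ (p≤factor d∣m) (p≤factor (quotient-∣ d∣m)) ⟩
    d * e  ≡⟨ m∣n⇒n≡m*quotient d∣m ⟨
    m      ∎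
  m≤bp : m ≤ b * p
  m≤bp = *-cancelʳ-≤ m (b * p) m (begin
    m * m        ≡⟨ cong (m *_) (*-identityʳ m) ⟨
    m ^ 2        ≤⟨ m²≤bpm ⟩
    b * (p * m)  ≡⟨ *-assoc b p m ⟨
    b * p * m    ∎)
  p≤b : p ≤ b
  p≤b = *-cancelʳ-≤ p b p (≤-trans p²≤m m≤bp)
  rearrange : ∀ x y → x * (y * x) ≡ y * (x * x)
  rearrange = solve-∀

factored-solution-bound : ∀ {b p} m → b ≢ 3 → Prime p → p Rough (p * m) → Solution b (p * m) →
                          p * m ≤ b ^ 3
factored-solution-bound {b} {p} zero _ _ _ _ = subst (_≤ b ^ 3) (sym (*-zeroʳ p)) z≤n
factored-solution-bound {b} {p} 1 _ p-prime _ sol =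
  ⊥-elim (prime-not-solution {b} (subst Prime (sym (*-identityʳ p)) p-prime) sol)
factored-solution-bound {b} {p} m@(suc (suc _)) b≢3 p-prime p-rough sol with composite? m
... | yes m-composite =
  rough-composite-bound {b} p-rough m-composite (proper-divisor-bound {b} (n∣m*n p) m<pm sol)
  where
  instance
    p≢0 : NonZero p
    p≢0 = prime⇒nonZero p-prime
    pm≢0 : NonZero (p * m)
    pm≢0 = m*n≢0 p m
  m<pm : m < p * m
  m<pm = subst (m <_) (*-comm m p) (m<m*n m p (prime>1 p-prime))
... | no m-not-composite with m≤n⇒m<n∨m≡n (rough∧∣⇒≤ p-rough (n∣m*n p))
...   | inj₁ p<m =
  ⊥-elim (b≢3 (prime*prime-solution⇒≡3 {b} p-prime (¬composite⇒prime m-not-composite) p<m sol))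
...   | inj₂ refl = ⊥-elim (prime²-not-solution {b} p-prime sol)

solution-bound : ∀ {b} n → .{{NonZero b}} → b ≢ 3 → Solution b n → n ≤ b ^ 3
solution-bound     0 _ _ = z≤n
solution-bound {b} 1 _ _ = >-nonZero⁻¹ (b ^ 3) {{m^n≢0 b 3}}
solution-bound {b} n@(suc (suc _)) b≢3 sol with leastPrimeFactor n
... | p , p-prime , p∣n , p-rough =
  subst (λ n → p Rough n → Solution b n → n ≤ b ^ 3) (sym (m∣n⇒n≡m*quotient p∣n))
        (factored-solution-bound (quotient p∣n) b≢3 p-prime) p-rough sol

no-solution-by-search : ∀ b → .{{NonZero b}} → b ≢ 3 →
                        True (allUpTo? (λ k → ¬? (solution? b (suc k))) (b ^ 3)) →
                        ∀ n → .{{NonZero n}} → ¬ Solution b n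
no-solution-by-search b b≢3 none-found (suc k) sol =
  toWitness none-found (solution-bound (suc k) b≢3 sol) sol

theorem1 : ((b : ℕ) → NonZero b → b ≢ 3 →
               ∃ λ N → (n : ℕ) → NonZero n → σ 2 n ≡ n ^ 2 + b * n → n ≤ N)
             × ((n : ℕ) → NonZero n → ¬ (σ 2 n ≡ n ^ 2 + 1 * n))
             × ((n : ℕ) → NonZero n → ¬ (σ 2 n ≡ n ^ 2 + 2 * n))
theorem1 =
  (λ b b≢0 b≢3 → b ^ 3 , λ n _ → solution-bound n {{b≢0}} b≢3) ,
  (λ n n≢0 → no-solution-by-search 1 (λ ()) _ n {{n≢0}}) ,
  (λ n n≢0 → no-solution-by-search 2 (λ ()) _ n {{n≢0}})
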